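{- Let $S$ be a modal Kleene algebra and $a\in S$. Then $a$ is Noetherian if and only if $a$ is pre-Löbian, i.e. if and only if $|a\rangle \le |a^+\rangle\,\max_a$ (pointwise: $|a\rangle p\le |a^+\rangle(p-|a\rangle p)$ for all $p\in\mathrm{test}(S)$).
   Context: An idempotent semiring is a structure $(S,+,\cdot,0,1)$ such that $(S,+,0)$ is a commutative monoid with $a+a=a$, $(S,\cdot,1)$ is a monoid, multiplication distributes over addition from both sides, and $0a=a0=0$. Its natural order is $a\le b\iff a+b=b$. A test is an element $p\le 1$ for which some $q$ satisfies $p+q=1$ and $pq=0=qp$; this $q$ is unique and written $\neg p$. The set $\mathrm{test}(S)$ of tests is a Boolean algebra (join $+$, meet $\cdot$, bottom $0$, top $1$, complement $\neg$); write $p-q=p\cdot\neg q$. $S$ is a modal semiring if for each $a\in S$ there are maps $|a\rangle,\langle a|:\mathrm{test}(S)\to\mathrm{test}(S)$ such that for all $a,b\in S$ and tests $p,q$: $|a\rangle p\le q\iff \neg q\,a\,p\le 0$; $\langle a|p\le q\iff p\,a\,\neg q\le 0$; $|ab\rangle p=|a\rangle(|b\rangle p)$; $\langle ab|p=\langle b|(\langle a|p)$. Maps $\mathrm{test}(S)\to\mathrm{test}(S)$ are ordered and combined pointwise; juxtaposition of maps denotes composition. A Kleene algebra is an idempotent semiring with an operation ${}^*$ such that $1+aa^*\le a^*$, $b+ac\le c\Rightarrow a^*b\le c$, $1+a^*a\le a^*$, and $b+ca\le c\Rightarrow ba^*\le c$; $a^+=aa^*$. A modal Kleene algebra is a Kleene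 algebra that is a modal semiring. For $a\in S$, $\max_a$ is the map $p\mapsto p-|a\rangle p$. The element $a$ is Noetherian if for all tests $p$, $\max_a p\le 0$ implies $p\le 0$. -}

module Defs where

open import Level using (0ℓ)
open import Data.Product using (_×_; _,_)
open import Function.Bundles using (_⇔_)
open import Relation.Binary.PropositionalEquality
  using (_≡_; refl; sym; trans; cong; cong₂; module ≡-Reasoning)

record IdempotentSemiring : Set₁ where
  infixl 6 _+_
  infixl 7 _·_
  field
    S   : Set
    _+_ : S → S → S
    _·_ : S → S → S
    𝟘   : S
    𝟙   : S
    +-assoc     : ∀ a b c → (a + b) + c ≡ a + (b + c)
    +-comm      : ∀ a b → a + b ≡ b + a
    +-identityˡ : ∀ a → 𝟘 + a ≡ a
    +-idem      : ∀ a → a + a ≡ a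
    ·-assoc     : ∀ a b c → (a · b) · c ≡ a · (b · c)
    ·-identityˡ : ∀ a → 𝟙 · a ≡ a
    ·-identityʳ : ∀ a → a · 𝟙 ≡ a
    distribˡ    : ∀ a b c → a · (b + c) ≡ a · b + a · c
    distribʳ    : ∀ a b c → (b + c) · a ≡ b · a + c · a
    zeroˡ       : ∀ a → 𝟘 · a ≡ 𝟘
    zeroʳ       : ∀ a → a · 𝟘 ≡ 𝟘

  infix 4 _≤_
  _≤_ : S → S → Set
  a ≤ b = a + b ≡ b

  record Test : Set where
    field
      elt   : S
      comp  : S
      ≤𝟙    : elt ≤ 𝟙
      sum   : elt + comp ≡ 𝟙
      prodˡ : elt · comp ≡ 𝟘
      prodʳ : comp · elt ≡ 𝟘
  open Test public

  infix 4 _≤ₜ_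
  _≤ₜ_ : Test → Test → Set
  p ≤ₜ q = elt p ≤ elt q

  open ≡-Reasoning

  private
    +-identityʳ : ∀ a → a + 𝟘 ≡ a
    +-identityʳ a = trans (+-comm a 𝟘) (+-identityˡ a)

    antisym : ∀ {x y} → x ≤ y → y ≤ x → x ≡ y
    antisym {x} {y} xy yx = trans (sym yx) (trans (+-comm y x) xy)

    le0 : ∀ {x} → x ≤ 𝟘 → x ≡ 𝟘
    le0 {x} h = trans (sym (+-identityʳ x)) h

    monoL : ∀ z {x y} → x ≤ y → x · z ≤ y · z
    monoL z {x} {y} h = trans (sym (distribʳ z x y)) (cong (_· z) h)

    monoR : ∀ z {x y} → x ≤ y → z · x ≤ z · y
    monoR z {x} {y} h = trans (sym (distribˡ z x y)) (cong (z ·_) h)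

    ≤-trans : ∀ {x y z} → x ≤ y → y ≤ z → x ≤ z
    ≤-trans {x} {y} {z} xy yz = begin
      x + z        ≡⟨ cong (x +_) (sym yz) ⟩
      x + (y + z)  ≡⟨ sym (+-assoc x y z) ⟩
      (x + y) + z  ≡⟨ cong (_+ z) xy ⟩
      y + z        ≡⟨ yz ⟩
      z            ∎

    comm≤ : (p q : Test) → elt p · elt q ≤ elt q · elt p
    comm≤ p q = begin
        P · Q + Q · P          ≡⟨ cong (_+ Q · P) eq ⟩
        P · Q · P + Q · P      ≡⟨ h2 ⟩
        Q · P                  ∎
      where
        P = elt p
        Q = elt q
        h1 : P · Q · comp p ≡ 𝟘
        h1 = le0 (≤-trans (monoL (comp p) (monoR P (≤𝟙 q)))
                          (subst≤ (trans (cong (_· comp p) (·-identityʳ P)) (prodˡ p))))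
          where
            subst≤ : ∀ {x y} → x ≡ y → x ≤ y
            subst≤ {x} refl = +-idem x
        eq : P · Q ≡ P · Q · P
        eq = begin
          P · Q                              ≡⟨ sym (·-identityʳ (P · Q)) ⟩
          P · Q · 𝟙                          ≡⟨ cong (P · Q ·_) (sym (sum p)) ⟩
          P · Q · (P + comp p)               ≡⟨ distribˡ (P · Q) P (comp p) ⟩
          P · Q · P + P · Q · comp p         ≡⟨ cong (P · Q · P +_) h1 ⟩
          P · Q · P + 𝟘                      ≡⟨ +-identityʳ _ ⟩
          P · Q · P                          ∎
        h2 : P · Q · P ≤ Q · P
        h2 = subst (λ w → P · Q · P ≤ w · P) (·-identityˡ Q) (monoL P (monoL Q (≤𝟙 p)))
          where
            subst : (F : S → Set) {x y : S} → x ≡ y → F x → F y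
            subst F refl fx = fx

    comm : (p q : Test) → elt p · elt q ≡ elt q · elt p
    comm p q = antisym (comm≤ p q) (comm≤ q p)

  ¬ₜ : Test → Test
  ¬ₜ p = record
    { elt = comp p ; comp = elt p
    ; ≤𝟙 = begin
        comp p + 𝟙                       ≡⟨ cong (comp p +_) (sym (sum p)) ⟩
        comp p + (elt p + comp p)        ≡⟨ cong (comp p +_) (+-comm (elt p) (comp p)) ⟩
        comp p + (comp p + elt p)        ≡⟨ sym (+-assoc (comp p) (comp p) (elt p)) ⟩
        (comp p + comp p) + elt p        ≡⟨ cong (_+ elt p) (+-idem (comp p)) ⟩
        comp p + elt p                   ≡⟨ +-comm (comp p) (elt p) ⟩
        elt p + comp p                   ≡⟨ sum p ⟩
        𝟙                                ∎
    ; sum = trans (+-comm (comp p) (elt p)) (sum p)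
    ; prodˡ = prodʳ p
    ; prodʳ = prodˡ p }

  _∧ₜ_ : Test → Test → Test
  p ∧ₜ q = record
    { elt = P · Q ; comp = P' + P · Q'
    ; ≤𝟙 = begin
        P · Q + 𝟙                 ≡⟨ cong (P · Q +_) (sym (sum p)) ⟩
        P · Q + (P + P')          ≡⟨ sym (+-assoc (P · Q) P P') ⟩
        (P · Q + P) + P'          ≡⟨ cong (λ w → (P · Q + w) + P') (sym (·-identityʳ P)) ⟩
        (P · Q + P · 𝟙) + P'      ≡⟨ cong (_+ P') (sym (distribˡ P Q 𝟙)) ⟩
        P · (Q + 𝟙) + P'          ≡⟨ cong (λ w → P · w + P') (≤𝟙 q) ⟩
        P · 𝟙 + P'                ≡⟨ cong (_+ P') (·-identityʳ P) ⟩
        P + P'                    ≡⟨ sum p ⟩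
        𝟙                         ∎
    ; sum = begin
        P · Q + (P' + P · Q')     ≡⟨ cong (P · Q +_) (+-comm P' (P · Q')) ⟩
        P · Q + (P · Q' + P')     ≡⟨ sym (+-assoc (P · Q) (P · Q') P') ⟩
        (P · Q + P · Q') + P'     ≡⟨ cong (_+ P') (sym (distribˡ P Q Q')) ⟩
        P · (Q + Q') + P'         ≡⟨ cong (λ w → P · w + P') (sum q) ⟩
        P · 𝟙 + P'                ≡⟨ cong (_+ P') (·-identityʳ P) ⟩
        P + P'                    ≡⟨ sum p ⟩
        𝟙                         ∎
    ; prodˡ = begin
        P · Q · (P' + P · Q')              ≡⟨ distribˡ (P · Q) P' (P · Q') ⟩
        P · Q · P' + P · Q · (P · Q')      ≡⟨ cong₂ _+_ a1 a2 ⟩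
        𝟘 + 𝟘                              ≡⟨ +-identityˡ 𝟘 ⟩
        𝟘                                  ∎
    ; prodʳ = begin
        (P' + P · Q') · (P · Q)            ≡⟨ distribʳ (P · Q) P' (P · Q') ⟩
        P' · (P · Q) + P · Q' · (P · Q)    ≡⟨ cong₂ _+_ b1 b2 ⟩
        𝟘 + 𝟘                              ≡⟨ +-identityˡ 𝟘 ⟩
        𝟘                                  ∎
    }
    where
      P = elt p
      Q = elt q
      P' = comp p
      Q' = comp q
      a1 : P · Q · P' ≡ 𝟘
      a1 = begin
        P · Q · P'        ≡⟨ ·-assoc P Q P' ⟩
        P · (Q · P')      ≡⟨ cong (P ·_) (comm q (¬ₜ p)) ⟩
        P · (P' · Q)      ≡⟨ sym (·-assoc P P' Q) ⟩
        P · P' · Q        ≡⟨ cong (_· Q) (prodˡ p) ⟩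
        𝟘 · Q             ≡⟨ zeroˡ Q ⟩
        𝟘                 ∎
      a2 : P · Q · (P · Q') ≡ 𝟘
      a2 = begin
        P · Q · (P · Q')      ≡⟨ ·-assoc P Q (P · Q') ⟩
        P · (Q · (P · Q'))    ≡⟨ cong (P ·_) (sym (·-assoc Q P Q')) ⟩
        P · (Q · P · Q')      ≡⟨ cong (λ w → P · (w · Q')) (comm q p) ⟩
        P · (P · Q · Q')      ≡⟨ cong (P ·_) (·-assoc P Q Q') ⟩
        P · (P · (Q · Q'))    ≡⟨ cong (λ w → P · (P · w)) (prodˡ q) ⟩
        P · (P · 𝟘)           ≡⟨ cong (P ·_) (zeroʳ P) ⟩
        P · 𝟘                 ≡⟨ zeroʳ P ⟩
        𝟘                     ∎
      b1 : P' · (P · Q) ≡ 𝟘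
      b1 = trans (sym (·-assoc P' P Q)) (trans (cong (_· Q) (prodʳ p)) (zeroˡ Q))
      b2 : P · Q' · (P · Q) ≡ 𝟘
      b2 = begin
        P · Q' · (P · Q)      ≡⟨ ·-assoc P Q' (P · Q) ⟩
        P · (Q' · (P · Q))    ≡⟨ cong (P ·_) (sym (·-assoc Q' P Q)) ⟩
        P · (Q' · P · Q)      ≡⟨ cong (λ w → P · (w · Q)) (comm (¬ₜ q) p) ⟩
        P · (P · Q' · Q)      ≡⟨ cong (P ·_) (·-assoc P Q' Q) ⟩
        P · (P · (Q' · Q))    ≡⟨ cong (λ w → P · (P · w)) (prodʳ q) ⟩
        P · (P · 𝟘)           ≡⟨ cong (P ·_) (zeroʳ P) ⟩
        P · 𝟘                 ≡⟨ zeroʳ P ⟩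
        𝟘                     ∎

  _-ₜ_ : Test → Test → Test
  p -ₜ q = p ∧ₜ ¬ₜ q

record ModalKleeneAlgebra : Set₁ where
  field
    semiring : IdempotentSemiring
  open IdempotentSemiring semiring public
  field
    _⋆ : S → S
    ⋆-unfoldˡ : ∀ a → 𝟙 + a · (a ⋆) ≤ a ⋆
    ⋆-inductˡ : ∀ a b c → b + a · c ≤ c → (a ⋆) · b ≤ c
    ⋆-unfoldʳ : ∀ a → 𝟙 + (a ⋆) · a ≤ a ⋆
    ⋆-inductʳ : ∀ a b c → b + c · a ≤ c → b · (a ⋆) ≤ c
    ∣_⟩ : S → Test → Test
    ⟨_∣ : S → Test → Test
    fdia-def : ∀ a p q → (∣ a ⟩ p ≤ₜ q) ⇔ (comp q · a · elt p ≤ 𝟘)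
    bdia-def : ∀ a p q → (⟨ a ∣ p ≤ₜ q) ⇔ (elt p · a · comp q ≤ 𝟘)
    fdia-comp : ∀ a b p → elt (∣ a · b ⟩ p) ≡ elt (∣ a ⟩ (∣ b ⟩ p))
    bdia-comp : ∀ a b p → elt (⟨ a · b ∣ p) ≡ elt (⟨ b ∣ (⟨ a ∣ p))

  _⁺ : S → S
  a ⁺ = a · (a ⋆)

  max : S → Test → Test
  max a p = p -ₜ ∣ a ⟩ p

  Noetherian : S → Set
  Noetherian a = ∀ (p : Test) → elt (max a p) ≤ 𝟘 → elt p ≤ 𝟘

  PreLöbian : S → Set
  PreLöbian a = ∀ (p : Test) → ∣ a ⟩ p ≤ₜ ∣ a ⁺ ⟩ (max a p)

module Submission where

-- Write d = |a⟩p, m = max_a p = p - d and e = |a⁺⟩m.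
--
-- (⇐) If m = 0 then e = |a⁺⟩0 = 0, so pre-Löbianity gives d = 0; as
--     p = p·d + m, also p = 0.
-- (⇒) Put r = d - e.  Splitting p first along d and then along e shows
--     |a⟩p ≤ |a⟩r + e: the part p - d = m is sent into |a⟩m ≤ e, the part
--     p·d·e into |a⟩e ≤ e, and the part p·d·¬e ≤ r into |a⟩r.  Hence
--     r = d - e ≤ |a⟩r, i.e. max_a r = 0, so r = 0 by Noetherianity,
--     which says exactly d ≤ e.

open import Level using (0ℓ)
open import Function.Bundles using (_⇔_; mk⇔; Equivalence)
open import Relation.Binary.Bundles using (Poset)
open import Relation.Binary.PropositionalEquality
  using (_≡_; refl; sym; trans; cong; isEquivalence)
open import Defs

open Equivalence using (to; from)

module SemiringOrder (R : IdempotentSemiring) where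
  open IdempotentSemiring R

  ≤-trans : ∀ {x y z} → x ≤ y → y ≤ z → x ≤ z
  ≤-trans {x} {y} {z} x≤y y≤z =
    trans (cong (x +_) (sym y≤z))
      (trans (sym (+-assoc x y z)) (trans (cong (_+ z) x≤y) y≤z))

  antisym : ∀ {x y} → x ≤ y → y ≤ x → x ≡ y
  antisym {x} {y} x≤y y≤x = trans (sym y≤x) (trans (+-comm y x) x≤y)

  ≤-poset : Poset 0ℓ 0ℓ 0ℓ
  ≤-poset = record
    { Carrier = S ; _≈_ = _≡_ ; _≤_ = _≤_
    ; isPartialOrder = record
      { isPreorder = record
        { isEquivalence = isEquivalence
        ; reflexive = λ { {x} refl → +-idem x }
        ; trans = ≤-trans }
      ; antisym = antisym } }

  open import Relation.Binary.Reasoning.PartialOrder ≤-poset public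

  𝟘-least : ∀ x → 𝟘 ≤ x
  𝟘-least = +-identityˡ

  ·-monoˡ : ∀ z {x y} → x ≤ y → x · z ≤ y · z
  ·-monoˡ z {x} {y} x≤y = trans (sym (distribʳ z x y)) (cong (_· z) x≤y)

  ·-monoʳ : ∀ z {x y} → x ≤ y → z · x ≤ z · y
  ·-monoʳ z {x} {y} x≤y = trans (sym (distribˡ z x y)) (cong (z ·_) x≤y)

  ·-≤𝟘ʳ : ∀ z {x} → x ≤ 𝟘 → z · x ≤ 𝟘
  ·-≤𝟘ʳ z {x} x≤𝟘 = begin z · x ≤⟨ ·-monoʳ z x≤𝟘 ⟩ z · 𝟘 ≡⟨ zeroʳ z ⟩ 𝟘 ∎

  +-lub : ∀ {x y z} → x ≤ z → y ≤ z → x + y ≤ z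
  +-lub {x} {y} {z} x≤z y≤z =
    trans (+-assoc x y z) (trans (cong (x +_) y≤z) x≤z)

  +-upperˡ : ∀ x y → x ≤ x + y
  +-upperˡ x y = trans (sym (+-assoc x x y)) (cong (_+ y) (+-idem x))

  +-upperʳ : ∀ x y → y ≤ x + y
  +-upperʳ x y = trans (sym (+-assoc y x y))
    (trans (cong (_+ y) (+-comm y x)) (trans (+-assoc x y y) (cong (x +_) (+-idem y))))

  test-absorbˡ : ∀ (t : Test) x → elt t · x ≤ x
  test-absorbˡ t x = begin elt t · x ≤⟨ ·-monoˡ x (≤𝟙 t) ⟩ 𝟙 · x ≡⟨ ·-identityˡ x ⟩ x ∎

  test-absorbʳ : ∀ x (t : Test) → x · elt t ≤ x
  test-absorbʳ x t = begin x · elt t ≤⟨ ·-monoʳ x (≤𝟙 t) ⟩ x · 𝟙 ≡⟨ ·-identityʳ x ⟩ x ∎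

  test-split : ∀ x (t : Test) → x ≡ x · elt t + x · comp t
  test-split x t = begin-equality
    x                        ≡⟨ sym (·-identityʳ x) ⟩
    x · 𝟙                    ≡⟨ cong (x ·_) (sym (sum t)) ⟩
    x · (elt t + comp t)     ≡⟨ distribˡ x (elt t) (comp t) ⟩
    x · elt t + x · comp t   ∎

  test-split-≤𝟘 : ∀ x (t : Test) → x · elt t ≤ 𝟘 → x · comp t ≤ 𝟘 → x ≤ 𝟘
  test-split-≤𝟘 x t x·t≤𝟘 x·¬t≤𝟘 =
    begin x ≡⟨ test-split x t ⟩ x · elt t + x · comp t ≤⟨ +-lub x·t≤𝟘 x·¬t≤𝟘 ⟩ 𝟘 ∎

  test-comm : (p q : Test) → elt p · elt q ≡ elt q · elt p
  test-comm p q = antisym (below p q) (below q p)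
    where
      below : (p q : Test) → elt p · elt q ≤ elt q · elt p
      below p q = begin
        P · Q                   ≡⟨ test-split (P · Q) p ⟩
        P · Q · P + P · Q · P'  ≤⟨ +-lub (·-monoˡ P (test-absorbˡ p Q)) vanishing ⟩
        Q · P                   ∎
        where
          P = elt p
          Q = elt q
          P' = comp p
          vanishing : P · Q · P' ≤ Q · P
          vanishing = begin
            P · Q · P' ≤⟨ ·-monoˡ P' (test-absorbʳ P q) ⟩
            P · P'     ≡⟨ prodˡ p ⟩
            𝟘          ≤⟨ 𝟘-least (Q · P) ⟩
            Q · P      ∎

  test-≤⇔ : (u v : Test) → (u ≤ₜ v) ⇔ (elt u · comp v ≤ 𝟘)
  test-≤⇔ u v = mk⇔ forward backward
    where
      forward : u ≤ₜ v → elt u · comp v ≤ 𝟘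
      forward u≤v = begin
        elt u · comp v ≤⟨ ·-monoˡ (comp v) u≤v ⟩
        elt v · comp v ≡⟨ prodˡ v ⟩
        𝟘              ∎
      backward : elt u · comp v ≤ 𝟘 → u ≤ₜ v
      backward u-v≤𝟘 = begin
        elt u                              ≡⟨ test-split (elt u) v ⟩
        elt u · elt v + elt u · comp v     ≤⟨ +-lub (test-absorbˡ u (elt v))
                                                  (≤-trans u-v≤𝟘 (𝟘-least (elt v))) ⟩
        elt v                              ∎

  ⊥ₜ : Test
  ⊥ₜ = record { elt = 𝟘 ; comp = 𝟙 ; ≤𝟙 = +-identityˡ 𝟙 ; sum = +-identityˡ 𝟙
              ; prodˡ = zeroˡ 𝟙 ; prodʳ = ·-identityˡ 𝟘 }

  _∨ₜ_ : Test → Test → Test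
  v ∨ₜ w = ¬ₜ (¬ₜ v ∧ₜ ¬ₜ w)

  ∨-upperˡ : (v w : Test) → v ≤ₜ v ∨ₜ w
  ∨-upperˡ v w = from (test-≤⇔ v (v ∨ₜ w)) (begin
    elt v · (comp v · comp w) ≡⟨ sym (·-assoc (elt v) (comp v) (comp w)) ⟩
    elt v · comp v · comp w   ≡⟨ cong (_· comp w) (prodˡ v) ⟩
    𝟘 · comp w                ≡⟨ zeroˡ (comp w) ⟩
    𝟘                         ∎)

  ∨-upperʳ : (v w : Test) → w ≤ₜ v ∨ₜ w
  ∨-upperʳ v w = from (test-≤⇔ w (v ∨ₜ w)) (begin
    elt w · (comp v · comp w) ≡⟨ sym (·-assoc (elt w) (comp v) (comp w)) ⟩
    elt w · comp v · comp w   ≡⟨ cong (_· comp w) (test-comm w (¬ₜ v)) ⟩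
    comp v · elt w · comp w   ≡⟨ ·-assoc (comp v) (elt w) (comp w) ⟩
    comp v · (elt w · comp w) ≡⟨ cong (comp v ·_) (prodˡ w) ⟩
    comp v · 𝟘                ≡⟨ zeroʳ (comp v) ⟩
    𝟘                         ∎)

  shunt : (u v w : Test) → u ≤ₜ v ∨ₜ w → u -ₜ w ≤ₜ v
  shunt u v w u≤v∨w = from (test-≤⇔ (u -ₜ w) v) (begin
    elt u · comp w · comp v   ≡⟨ ·-assoc (elt u) (comp w) (comp v) ⟩
    elt u · (comp w · comp v) ≡⟨ cong (elt u ·_) (test-comm (¬ₜ w) (¬ₜ v)) ⟩
    elt u · (comp v · comp w) ≤⟨ to (test-≤⇔ u (v ∨ₜ w)) u≤v∨w ⟩
    𝟘                         ∎)

module ModalLaws (K : ModalKleeneAlgebra) where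
  open ModalKleeneAlgebra K
  open SemiringOrder semiring

  -- The defining Galois property of |x⟩, read off at the upper bound |x⟩p.
  dia-unit : ∀ x p → comp (∣ x ⟩ p) · x · elt p ≤ 𝟘
  dia-unit x p = to (fdia-def x p (∣ x ⟩ p)) (+-idem (elt (∣ x ⟩ p)))

  dia-mono-elt : ∀ {x y} → x ≤ y → ∀ p → ∣ x ⟩ p ≤ₜ ∣ y ⟩ p
  dia-mono-elt {x} {y} x≤y p = from (fdia-def x p (∣ y ⟩ p)) (begin
    comp (∣ y ⟩ p) · x · elt p ≤⟨ ·-monoˡ (elt p) (·-monoʳ (comp (∣ y ⟩ p)) x≤y) ⟩
    comp (∣ y ⟩ p) · y · elt p ≤⟨ dia-unit y p ⟩
    𝟘                          ∎)

  dia-mono-test : ∀ x {p q} → p ≤ₜ q → ∣ x ⟩ p ≤ₜ ∣ x ⟩ q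
  dia-mono-test x {p} {q} p≤q = from (fdia-def x p (∣ x ⟩ q)) (begin
    comp (∣ x ⟩ q) · x · elt p ≤⟨ ·-monoʳ (comp (∣ x ⟩ q) · x) p≤q ⟩
    comp (∣ x ⟩ q) · x · elt q ≤⟨ dia-unit x q ⟩
    𝟘                          ∎)

  dia-strict : ∀ x p → elt p ≤ 𝟘 → elt (∣ x ⟩ p) ≤ 𝟘
  dia-strict x p p≤𝟘 = from (fdia-def x p ⊥ₜ) (·-≤𝟘ʳ (𝟙 · x) p≤𝟘)

  dia-cases : ∀ x p t s → ∣ x ⟩ (p ∧ₜ t) ≤ₜ s → ∣ x ⟩ (p -ₜ t) ≤ₜ s → ∣ x ⟩ p ≤ₜ s
  dia-cases x p t s inside outside = from (fdia-def x p s) (begin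
    comp s · x · elt p                  ≡⟨ cong (comp s · x ·_) (test-split (elt p) t) ⟩
    comp s · x · (elt p · elt t + elt p · comp t)
                                        ≡⟨ distribˡ (comp s · x) _ _ ⟩
    comp s · x · (elt p · elt t) + comp s · x · (elt p · comp t)
                                        ≤⟨ +-lub (to (fdia-def x (p ∧ₜ t) s) inside)
                                                 (to (fdia-def x (p -ₜ t) s) outside) ⟩
    𝟘                                   ∎)

  ≤⁺ : ∀ a → a ≤ a ⁺
  ≤⁺ a = begin
    a          ≡⟨ sym (·-identityʳ a) ⟩
    a · 𝟙      ≤⟨ ·-monoʳ a (≤-trans (+-upperˡ 𝟙 (a ⁺)) (⋆-unfoldˡ a)) ⟩
    a · (a ⋆)  ∎

  ·⁺≤⁺ : ∀ a → a · a ⁺ ≤ a ⁺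
  ·⁺≤⁺ a = ·-monoʳ a (≤-trans (+-upperʳ 𝟙 (a ⁺)) (⋆-unfoldˡ a))

  dia-≤⁺ : ∀ a p → ∣ a ⟩ p ≤ₜ ∣ a ⁺ ⟩ p
  dia-≤⁺ a = dia-mono-elt (≤⁺ a)

  dia-⁺-closed : ∀ a p → ∣ a ⟩ (∣ a ⁺ ⟩ p) ≤ₜ ∣ a ⁺ ⟩ p
  dia-⁺-closed a p = begin
    elt (∣ a ⟩ (∣ a ⁺ ⟩ p)) ≡⟨ sym (fdia-comp a (a ⁺) p) ⟩
    elt (∣ a · a ⁺ ⟩ p)     ≤⟨ dia-mono-elt (·⁺≤⁺ a) p ⟩
    elt (∣ a ⁺ ⟩ p)         ∎

  preLöbian⇒noetherian : ∀ a → PreLöbian a → Noetherian a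
  preLöbian⇒noetherian a preLöb p max≤𝟘 = test-split-≤𝟘 (elt p) (∣ a ⟩ p)
    (begin
      elt p · elt (∣ a ⟩ p)    ≤⟨ test-absorbˡ p _ ⟩
      elt (∣ a ⟩ p)            ≤⟨ preLöb p ⟩
      elt (∣ a ⁺ ⟩ (max a p))  ≤⟨ dia-strict (a ⁺) (max a p) max≤𝟘 ⟩
      𝟘                        ∎)
    max≤𝟘

  noetherian⇒preLöbian : ∀ a → Noetherian a → PreLöbian a
  noetherian⇒preLöbian a noether p =
    from (test-≤⇔ d e) (noether r (to (test-≤⇔ r (∣ a ⟩ r)) r≤|a⟩r))
    where
      d e r j : Test
      d = ∣ a ⟩ p
      e = ∣ a ⁺ ⟩ (max a p)
      r = d -ₜ e
      j = ∣ a ⟩ r ∨ₜ e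
      e≤j : e ≤ₜ j
      e≤j = ∨-upperʳ (∣ a ⟩ r) e
      -- p·d·e lies in e, which |a⟩ maps into e.
      inside : ∣ a ⟩ ((p ∧ₜ d) ∧ₜ e) ≤ₜ j
      inside = begin
        elt (∣ a ⟩ ((p ∧ₜ d) ∧ₜ e)) ≤⟨ dia-mono-test a (test-absorbˡ (p ∧ₜ d) (elt e)) ⟩
        elt (∣ a ⟩ e)               ≤⟨ dia-⁺-closed a (max a p) ⟩
        elt e                       ≤⟨ e≤j ⟩
        elt j                       ∎
      -- p·d·¬e lies in r.
      outside : ∣ a ⟩ ((p ∧ₜ d) -ₜ e) ≤ₜ j
      outside = begin
        elt (∣ a ⟩ ((p ∧ₜ d) -ₜ e)) ≤⟨ dia-mono-test a (·-monoˡ (comp e) (test-absorbˡ p (elt d))) ⟩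
        elt (∣ a ⟩ r)               ≤⟨ ∨-upperˡ (∣ a ⟩ r) e ⟩
        elt j                       ∎
      -- p - d is max_a p itself.
      maximal : ∣ a ⟩ (max a p) ≤ₜ j
      maximal = ≤-trans (dia-≤⁺ a (max a p)) e≤j
      d≤j : d ≤ₜ j
      d≤j = dia-cases a p d j (dia-cases a (p ∧ₜ d) e j inside outside) maximal
      r≤|a⟩r : r ≤ₜ ∣ a ⟩ r
      r≤|a⟩r = shunt d (∣ a ⟩ r) e d≤j

theorem5p5 : (K : ModalKleeneAlgebra) (a : ModalKleeneAlgebra.S K) → ModalKleeneAlgebra.Noetherian K a ⇔ ModalKleeneAlgebra.PreLöbian K a
theorem5p5 K a = mk⇔ (noetherian⇒preLöbian a) (preLöbian⇒noetherian a)
  where open ModalLaws K
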